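{- Let $\mathbb{I}$ be the icosahedron graph. Then $k(\mathbb{I})\ge 4$.
   Context: All graphs are simple and undirected. The icosahedron graph $\mathbb{I}$ is the graph formed by the $12$ vertices and $30$ edges of a regular icosahedron. The competition graph $C(D)$ of a digraph $D$ is the graph with vertex set $V(D)$ in which two distinct vertices $x,y$ are adjacent if and only if there is a vertex $v$ with $(x,v)$ and $(y,v)$ both arcs of $D$. The competition number $k(G)$ of a graph $G$ is the minimum integer $k\ge 0$ such that $G$ together with $k$ new isolated vertices is the competition graph of some acyclic digraph. -}

module Defs where

open import Data.Nat using (ℕ; _+_; _≡ᵇ_)
open import Data.Fin using (Fin; toℕ; splitAt)
open import Data.Bool using (Bool; true; false; _∧_; _∨_; T)
open import Data.List using (List; []; _∷_)
open import Data.Bool.ListAction using (any)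
open import Data.Product using (_×_; _,_; ∃-syntax)
open import Data.Sum using (_⊎_; inj₁; inj₂)
open import Data.Empty using (⊥)
open import Relation.Nullary using (¬_)
open import Relation.Binary.PropositionalEquality using (_≡_)

-- Edge list of the icosahedron graph on vertices 0..11:
-- 0 = top, 1..5 = upper pentagon, 6..10 = lower pentagon, 11 = bottom.
-- Upper vertex i is joined to lower vertices 5+i and 5+(i mod 5)+1.
icoEdges : List (ℕ × ℕ)
icoEdges =
  (0 , 1) ∷ (0 , 2) ∷ (0 , 3) ∷ (0 , 4) ∷ (0 , 5) ∷
  (1 , 2) ∷ (2 , 3) ∷ (3 , 4) ∷ (4 , 5) ∷ (5 , 1) ∷
  (6 , 7) ∷ (7 , 8) ∷ (8 , 9) ∷ (9 , 10) ∷ (10 , 6) ∷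
  (1 , 6) ∷ (1 , 7) ∷ (2 , 7) ∷ (2 , 8) ∷ (3 , 8) ∷
  (3 , 9) ∷ (4 , 9) ∷ (4 , 10) ∷ (5 , 10) ∷ (5 , 6) ∷
  (11 , 6) ∷ (11 , 7) ∷ (11 , 8) ∷ (11 , 9) ∷ (11 , 10) ∷ []

icoAdjᵇ : ℕ → ℕ → Bool
icoAdjᵇ a b = any (λ { (x , y) → ((x ≡ᵇ a) ∧ (y ≡ᵇ b)) ∨ ((x ≡ᵇ b) ∧ (y ≡ᵇ a)) }) icoEdges

Ico : Fin 12 → Fin 12 → Set
Ico x y = T (icoAdjᵇ (toℕ x) (toℕ y))

IcoPlus : (k : ℕ) → Fin (12 + k) → Fin (12 + k) → Set
IcoPlus k x y with splitAt 12 x | splitAt 12 y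
... | inj₁ a | inj₁ b = Ico a b
... | _      | _      = ⊥

Digraph : ℕ → Set₁
Digraph m = Fin m → Fin m → Set

data DPath {m : ℕ} (D : Digraph m) : Fin m → Fin m → Set where
  arc  : ∀ {x y} → D x y → DPath D x y
  _∷ᵖ_ : ∀ {x y z} → D x y → DPath D y z → DPath D x z

Acyclic : {m : ℕ} → Digraph m → Set
Acyclic D = ∀ x → ¬ DPath D x x

IsCompetitionGraphOf : {m : ℕ} → (Fin m → Fin m → Set) → Digraph m → Set
IsCompetitionGraphOf G D =
  ∀ x y → ¬ (x ≡ y) → (G x y → ∃[ v ] (D x v × D y v)) × (∃[ v ] (D x v × D y v) → G x y)

IcoPlusIsCompetition : ℕ → Set₁
IcoPlusIsCompetition k = ∃[ D ] (Acyclic {12 + k} D × IsCompetitionGraphOf (IcoPlus k) D)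

-- Suppose k ≤ 3 and D is an acyclic digraph with C(D) = 𝕀 ∪ I_k.  Repeatedly removing a
-- sink of D restricted to 𝕀 gives vertices z, y, x of 𝕀 such that every prey of z is one
-- of the k new vertices, every prey of y is new or z, and every prey of x is new, z or y.
-- Give each edge at z, y or x a common prey of its ends as its colour: at most five
-- colours occur, and the ends of all edges of one colour are pairwise adjacent, since they
-- compete for the same prey.  An exhaustive search over all triples z, y, x shows that no
-- such colouring exists; permuting the new vertices fixes the colours of two edges at z,
-- which keeps the search small.
module Submission where

open import Defs
open import Data.Bool using (Bool; true; _∧_; T)
open import Data.Bool.ListAction using (all; any)
open import Data.Bool.Properties using (T-∧)
open import Data.Empty using (⊥; ⊥-elim)
open import Data.Fin using (Fin; suc; toℕ; _↑ˡ_; splitAt; join; inject≤)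
open import Data.Fin.Patterns
open import Data.Fin.Permutation
  using (Permutation′; _⟨$⟩ʳ_; _⟨$⟩ˡ_; inverseˡ; transpose; _∘ₚ_)
open import Data.Fin.Properties
  using ( _≟_; all?; any?; ¬∀⟶∃¬; pigeonhole; <-irrefl
        ; ↑ˡ-injective; splitAt-↑ˡ; join-splitAt; inject≤-injective)
open import Data.List using (List; []; _∷_; map; filter; _++_; allFin; length; lookup)
open import Data.List.Membership.Propositional using (_∈_; _∉_; lose)
open import Data.List.Membership.Propositional.Properties
  using (∈-map⁺; ∈-++⁺ˡ; ∈-++⁺ʳ; ∈-allFin; ∈-filter⁻)
open import Data.List.Relation.Unary.All using (All; []; _∷_; tabulate)
open import Data.List.Relation.Unary.All.Properties
  using (all⁻; ++⁺) renaming (map⁺ to All-map⁺)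
open import Data.List.Relation.Unary.Any as Any using (here; there; index)
open import Data.List.Relation.Unary.Any.Properties using (any⁺; lookup-index)
open import Data.Nat as ℕ using (ℕ; zero; suc; _+_; _≤_; _≤?_; z<s; s<s)
open import Data.Nat.Properties using (≤-pred; ≰⇒>; n<1+n; m≤n⇒m<n∨m≡n)
open import Data.Product as Product using (∃; _×_; _,_; proj₁; proj₂)
open import Data.Sum as Sum using (_⊎_; inj₁; inj₂)
open import Data.Sum.Properties using (≡-dec; inj₂-injective)
open import Data.Unit using (⊤; tt)
open import Data.Vec as Vec using (Vec; []; _∷_; toList)
open import Data.Vec.Membership.Propositional using () renaming (_∈_ to _∈ᵛ_)
open import Data.Vec.Membership.Propositional.Properties using (∈-lookup; ∈-toList⁻)
open import Data.Vec.Relation.Unary.Any as Anyᵛ using ()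
open import Function using (_∘_; Equivalence)
open import Relation.Binary.Definitions using (DecidableEquality)
open import Relation.Binary.PropositionalEquality using (_≡_; _≢_; refl; sym; trans; cong; subst)
open import Relation.Nullary using (Dec; isYes; yes; no; ¬_; ¬?)
open import Relation.Nullary.Decidable
  using (from-yes; fromWitness; decidable-stable; _→-dec_; _×-dec_; _⊎-dec_; T?)

infix 4 _∈?_ _∉?_

_∈?_ : ∀ {n} (v : Fin n) (vs : List (Fin n)) → Dec (v ∈ vs)
v ∈? vs = Any.any? (v ≟_) vs

_∉?_ : ∀ {n} (v : Fin n) (vs : List (Fin n)) → Dec (v ∉ vs)
v ∉? vs = ¬? (v ∈? vs)

DPath-map : ∀ {m n} {R : Digraph m} {S : Digraph n} (f : Fin m → Fin n) →
            (∀ {x y} → R x y → S (f x) (f y)) → ∀ {x y} → DPath R x y → DPath S (f x) (f y)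
DPath-map f h (arc r)  = arc (h r)
DPath-map f h (r ∷ᵖ p) = h r ∷ᵖ DPath-map f h p

module _ {n} {R : Digraph n} where

  _▷_ : ∀ {x y w} → DPath R x y → R y w → DPath R x w
  arc r    ▷ r′ = r ∷ᵖ arc r′
  (r ∷ᵖ p) ▷ r′ = r ∷ᵖ (p ▷ r′)

  -- A walk of n + 1 steps inside P repeats a vertex.
  successor-closed⇒empty : Acyclic R → ∀ {p} {P : Fin n → Set p} →
                           (∀ {u} → P u → ∃ λ v → P v × R u v) → ∀ {u} → ¬ P u
  successor-closed⇒empty acyclic {P = P} next {u} pu =
    let i , j , i<j , same = pigeonhole (n<1+n n) (λ t → proj₁ (walk (toℕ t)))
    in acyclic _ (subst (λ w → DPath R w (proj₁ (walk (toℕ j)))) same (path i<j))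
    where
      walk : ℕ → ∃ P
      walk zero    = u , pu
      walk (suc i) = Product.map₂ proj₁ (next (proj₂ (walk i)))

      step : ∀ i → R (proj₁ (walk i)) (proj₁ (walk (suc i)))
      step i = proj₂ (proj₂ (next (proj₂ (walk i))))

      path : ∀ {i j} → i ℕ.< j → DPath R (proj₁ (walk i)) (proj₁ (walk j))
      path {i} {suc j} (ℕ.s≤s i≤j) with m≤n⇒m<n∨m≡n i≤j
      ... | inj₁ i<j  = path i<j ▷ step j
      ... | inj₂ refl = arc (step i)

  ∃-∉-short : (vs : List (Fin n)) → length vs ℕ.< n → ∃ λ v → v ∉ vs
  ∃-∉-short vs short = decidable-stable (any? (_∉? vs)) λ none →
    let everywhere : ∀ v → v ∈ vs
        everywhere v = decidable-stable (v ∈? vs) (λ v∉ → none (v , v∉))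
        i , j , i<j , same = pigeonhole short (λ v → index (everywhere v))
    in <-irrefl (trans (lookup-index (everywhere i))
                       (trans (cong (lookup vs) same) (sym (lookup-index (everywhere j))))) i<j

  ∃-sinkOutside : (∀ u v → Dec (R u v)) → Acyclic R →
                  (olds : List (Fin n)) → length olds ℕ.< n →
                  ∃ λ u → u ∉ olds × (∀ {v} → R u v → v ∈ olds)
  ∃-sinkOutside R? acyclic olds short
    with any? (λ u → u ∉? olds ×-dec all? (λ v → R? u v →-dec v ∈? olds))
  ... | yes (u , u∉ , exits) = u , u∉ , exits _
  ... | no  none =
    ⊥-elim (successor-closed⇒empty acyclic escape (proj₂ (∃-∉-short olds short)))
    where
      escape : ∀ {u} → u ∉ olds → ∃ λ v → v ∉ olds × R u v
      escape {u} u∉ =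
        let v , ¬exit = ¬∀⟶∃¬ n _ (λ v → R? u v →-dec v ∈? olds)
                                  (λ exits → none (u , u∉ , exits))
        in v , (λ v∈ → ¬exit (λ _ → v∈))
             , decidable-stable (R? u v) (λ ¬r → ¬exit (⊥-elim ∘ ¬r))

pattern 10F = suc 9F
pattern 11F = suc 10F

Vertex : Set
Vertex = Fin 12

-- The adjacency of `Ico` as a neighbour table, which evaluates much faster.
neighbours : Vertex → Vec Vertex 5
neighbours 0F  = 1F ∷ 2F ∷ 3F ∷ 4F  ∷ 5F  ∷ []
neighbours 1F  = 0F ∷ 2F ∷ 5F ∷ 6F  ∷ 7F  ∷ []
neighbours 2F  = 0F ∷ 1F ∷ 3F ∷ 7F  ∷ 8F  ∷ []
neighbours 3F  = 0F ∷ 2F ∷ 4F ∷ 8F  ∷ 9F  ∷ []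
neighbours 4F  = 0F ∷ 3F ∷ 5F ∷ 9F  ∷ 10F ∷ []
neighbours 5F  = 0F ∷ 1F ∷ 4F ∷ 6F  ∷ 10F ∷ []
neighbours 6F  = 1F ∷ 5F ∷ 7F ∷ 10F ∷ 11F ∷ []
neighbours 7F  = 1F ∷ 2F ∷ 6F ∷ 8F  ∷ 11F ∷ []
neighbours 8F  = 2F ∷ 3F ∷ 7F ∷ 9F  ∷ 11F ∷ []
neighbours 9F  = 3F ∷ 4F ∷ 8F ∷ 10F ∷ 11F ∷ []
neighbours 10F = 4F ∷ 5F ∷ 6F ∷ 9F  ∷ 11F ∷ []
neighbours 11F = 6F ∷ 7F ∷ 8F ∷ 9F  ∷ 10F ∷ []

Adjacent : Vertex → Vertex → Set
Adjacent a b = b ∈ᵛ neighbours a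

adjacent? : ∀ a b → Dec (Adjacent a b)
adjacent? a b = Anyᵛ.any? (b ≟_) (neighbours a)

Ico⇒Adjacent : ∀ a b → Ico a b → Adjacent a b
Ico⇒Adjacent = from-yes (all? λ a → all? λ b →
  T? (icoAdjᵇ (toℕ a) (toℕ b)) →-dec adjacent? a b)

Adjacent⇒Ico : ∀ a b → Adjacent a b → Ico a b
Adjacent⇒Ico = from-yes (all? λ a → all? λ b →
  adjacent? a b →-dec T? (icoAdjᵇ (toℕ a) (toℕ b)))

adjacent-irreflexive : ∀ a → ¬ Adjacent a a
adjacent-irreflexive = from-yes (all? λ a → ¬? (adjacent? a a))

spoke : Vertex → Fin 5 → Vertex
spoke a = Vec.lookup (neighbours a)

spoke-adjacent : ∀ a i → Adjacent a (spoke a i)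
spoke-adjacent a i = ∈-lookup i (neighbours a)

Compatible : Vertex → Vertex → Set
Compatible a b = a ≡ b ⊎ Adjacent a b

compatible? : ∀ a b → Dec (Compatible a b)
compatible? a b = a ≟ b ⊎-dec adjacent? a b

-- A prey is an old vertex of 𝕀 (inj₁) or one of at most three new vertices (inj₂).
Colour : Set
Colour = Vertex ⊎ Fin 3

_≟ᶜ_ : DecidableEquality Colour
_≟ᶜ_ = ≡-dec _≟_ _≟_

Admissible : List Vertex → Colour → Set
Admissible olds (inj₁ v) = v ∈ olds
Admissible olds (inj₂ _) = ⊤

admissible : List Vertex → List Colour
admissible olds = map inj₁ olds ++ map inj₂ (allFin 3)

admissible-complete : ∀ olds {c} → Admissible olds c → c ∈ admissible olds
admissible-complete olds {inj₁ v} v∈ = ∈-++⁺ˡ (∈-map⁺ inj₁ v∈)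
admissible-complete olds {inj₂ i} _  = ∈-++⁺ʳ (map inj₁ olds) (∈-map⁺ inj₂ (∈-allFin i))

admissible-map₂ : ∀ {olds} (f : Fin 3 → Fin 3) c →
                  Admissible olds c → Admissible olds (Sum.map₂ f c)
admissible-map₂ f (inj₁ v) v∈ = v∈
admissible-map₂ f (inj₂ i) _  = tt

new-colour : ∀ {c} → Admissible [] c → ∃ λ i → c ≡ inj₂ i
new-colour {inj₂ i} _ = i , refl

-- What a competition digraph for 𝕀 ∪ I₃ induces on 𝕀: `Eats a c` is an arc from a to
-- the prey c, and `prey a b` is a common prey of a and b (junk unless they are adjacent).
record PreyStructure : Set₁ where
  field
    Eats        : Vertex → Colour → Set
    prey        : Vertex → Vertex → Colour
    prey-eaten  : ∀ {a b} → Adjacent a b → Eats a (prey a b) × Eats b (prey a b)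
    competition : ∀ {a b c} → Eats a c → Eats b c → Compatible a b

  PreysWithin : List Vertex → Vertex → Set
  PreysWithin olds u = ∀ {b} → Adjacent u b → Admissible olds (prey u b)

relabel : Permutation′ 3 → PreyStructure → PreyStructure
relabel ς S = record
  { Eats        = λ a c → Eats a (Sum.map₂ (ς ⟨$⟩ˡ_) c)
  ; prey        = λ a b → Sum.map₂ (ς ⟨$⟩ʳ_) (prey a b)
  ; prey-eaten  = λ e → restore (proj₁ (prey-eaten e)) , restore (proj₂ (prey-eaten e))
  ; competition = competition
  }
  where
    open PreyStructure S
    restore : ∀ {a c} → Eats a c → Eats a (Sum.map₂ (ς ⟨$⟩ˡ_) (Sum.map₂ (ς ⟨$⟩ʳ_) c))
    restore {c = inj₁ v} ea = ea
    restore {c = inj₂ i} ea = subst (Eats _ ∘ inj₂) (sym (inverseˡ ς)) ea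

relabel-preysWithin : ∀ ς S {olds u} → PreyStructure.PreysWithin S olds u →
                      PreyStructure.PreysWithin (relabel ς S) olds u
relabel-preysWithin ς S preysWithin e = admissible-map₂ (ς ⟨$⟩ʳ_) _ (preysWithin e)

orderNew : Fin 3 → Fin 3 → Permutation′ 3
orderNew c₁ c₂ with c₂ ≟ c₁
... | yes _ = transpose c₁ 0F
... | no  _ = transpose c₁ 0F ∘ₚ transpose (transpose c₁ 0F ⟨$⟩ʳ c₂) 1F

orderNew-ordered : ∀ c₁ c₂ →
                   orderNew c₁ c₂ ⟨$⟩ʳ c₁ ≡ 0F × orderNew c₁ c₂ ⟨$⟩ʳ c₂ ∈ 0F ∷ 1F ∷ []
orderNew-ordered = from-yes (all? λ c₁ → all? λ c₂ →
  (orderNew c₁ c₂ ⟨$⟩ʳ c₁ ≟ 0F) ×-dec (orderNew c₁ c₂ ⟨$⟩ʳ c₂ ∈? 0F ∷ 1F ∷ []))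

-- `classes c` lists the vertices already known to eat the prey c.
Classes : Set
Classes = Colour → List Vertex

noClasses : Classes
noClasses _ = []

extend : Colour → Vertex → Vertex → Classes → Classes
extend c a b classes d with c ≟ᶜ d
... | yes _ = a ∷ b ∷ classes d
... | no  _ = classes d

joins : Vertex → List Vertex → Bool
joins a = all (λ u → isYes (compatible? u a))

-- An edge together with the colours its prey may have.
Demand : Set
Demand = Vertex × Vertex × List Colour

colourable : List Demand → Classes → Bool
colourable []                   classes = true
colourable ((a , b , cs) ∷ ds) classes =
  any (λ c → joins a (classes c) ∧ joins b (classes c) ∧
             colourable ds (extend c a b classes)) cs

Satisfied : PreyStructure → Demand → Set
Satisfied S (a , b , cs) = Adjacent a b × PreyStructure.prey S a b ∈ cs

-- Edges back to earlier sinks are demanded there already; dropping them halves the search.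
edgeDemands : List Vertex → Vertex → List Demand
edgeDemands olds u =
  map (λ b → u , b , admissible olds) (filter (_∉? olds) (toList (neighbours u)))

-- The first two spokes carry the colours normalised by `orderNew`.
spokeDemands : Vertex → List Demand
spokeDemands z =
  (z , spoke z 0F , inj₂ 0F ∷ []) ∷ (z , spoke z 1F , map inj₂ (0F ∷ 1F ∷ [])) ∷
  map (λ i → z , spoke z i , admissible []) (2F ∷ 3F ∷ 4F ∷ [])

demands : Vertex → Vertex → Vertex → List Demand
demands z y x = spokeDemands z ++ edgeDemands (z ∷ []) y ++ edgeDemands (y ∷ z ∷ []) x

noCanonicalColouring : ∀ z y x → y ∉ z ∷ [] → x ∉ y ∷ z ∷ [] →
                       ¬ T (colourable (demands z y x) noClasses)
noCanonicalColouring = from-yes (all? λ z → all? λ y → all? λ x →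
  y ∉? z ∷ [] →-dec x ∉? y ∷ z ∷ [] →-dec ¬? (T? (colourable (demands z y x) noClasses)))

module _ (S : PreyStructure) where
  open PreyStructure S

  Consistent : Classes → Set
  Consistent classes = ∀ c {u} → u ∈ classes c → Eats u c

  extend-consistent : ∀ {classes a b c} → Consistent classes → Eats a c → Eats b c →
                      Consistent (extend c a b classes)
  extend-consistent {c = c} consistent ea eb d u∈ with c ≟ᶜ d
  extend-consistent consistent ea eb _ (here refl)         | yes refl = ea
  extend-consistent consistent ea eb _ (there (here refl)) | yes refl = eb
  extend-consistent consistent ea eb d (there (there u∈))  | yes refl = consistent d u∈
  extend-consistent consistent ea eb d u∈                  | no _     = consistent d u∈

  joins-complete : ∀ {classes a c} → Consistent classes → Eats a c → T (joins a (classes c))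
  joins-complete consistent ea =
    all⁻ _ (tabulate λ u∈ → fromWitness (competition (consistent _ u∈) ea))

  colourable-complete : ∀ ds {classes} → Consistent classes → All (Satisfied S) ds →
                        T (colourable ds classes)
  colourable-complete []                  _          []                  = tt
  colourable-complete ((a , b , cs) ∷ ds) consistent ((e , c∈cs) ∷ sat) =
    any⁺ _ (lose c∈cs (Equivalence.from T-∧ (joins-complete consistent ea ,
      Equivalence.from T-∧ (joins-complete consistent eb ,
        colourable-complete ds (extend-consistent consistent ea eb) sat))))
    where
      ea = proj₁ (prey-eaten e)
      eb = proj₂ (prey-eaten e)

  edgeDemands-satisfied : ∀ {olds u} → PreysWithin olds u →
                          All (Satisfied S) (edgeDemands olds u)
  edgeDemands-satisfied {olds} preysWithin = All-map⁺ (tabulate λ b∈ →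
    let e = ∈-toList⁻ (proj₁ (∈-filter⁻ (_∉? olds) b∈))
    in e , admissible-complete olds (preysWithin e))

  spokeDemands-satisfied : ∀ {z} → PreysWithin [] z →
                           prey z (spoke z 0F) ≡ inj₂ 0F →
                           prey z (spoke z 1F) ∈ map inj₂ (0F ∷ 1F ∷ []) →
                           All (Satisfied S) (spokeDemands z)
  spokeDemands-satisfied {z} preysWithin first second =
    (spoke-adjacent z 0F , here first) ∷ (spoke-adjacent z 1F , second) ∷
    All-map⁺ {f = λ i → z , spoke z i , admissible []}
      (admissible-spoke 2F ∷ admissible-spoke 3F ∷ admissible-spoke 4F ∷ [])
    where
      admissible-spoke : ∀ i → Satisfied S (z , spoke z i , admissible [])
      admissible-spoke i =
        spoke-adjacent z i , admissible-complete [] (preysWithin (spoke-adjacent z i))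

noThreeSinks : (S : PreyStructure) → let open PreyStructure S in
               ∀ {z y x} → y ∉ z ∷ [] → x ∉ y ∷ z ∷ [] →
               PreysWithin [] z → PreysWithin (z ∷ []) y → PreysWithin (y ∷ z ∷ []) x → ⊥
noThreeSinks S {z} {y} {x} y∉ x∉ atZ atY atX =
  noCanonicalColouring z y x y∉ x∉ (colourable-complete S′ (demands z y x) {noClasses} (λ _ ())
    (++⁺ (spokeDemands-satisfied S′ (within atZ) first second)
         (++⁺ (edgeDemands-satisfied S′ (within atY)) (edgeDemands-satisfied S′ (within atX)))))
  where
    open PreyStructure S
    c₁ = new-colour (atZ (spoke-adjacent z 0F))
    c₂ = new-colour (atZ (spoke-adjacent z 1F))
    ς = orderNew (proj₁ c₁) (proj₁ c₂)
    S′ = relabel ς S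

    within : ∀ {olds u} → PreysWithin olds u → PreyStructure.PreysWithin S′ olds u
    within = relabel-preysWithin ς S

    first : PreyStructure.prey S′ z (spoke z 0F) ≡ inj₂ 0F
    first = trans (cong (Sum.map₂ (ς ⟨$⟩ʳ_)) (proj₂ c₁))
                  (cong inj₂ (proj₁ (orderNew-ordered (proj₁ c₁) (proj₁ c₂))))

    second : PreyStructure.prey S′ z (spoke z 1F) ∈ map inj₂ (0F ∷ 1F ∷ [])
    second = subst (_∈ _) (sym (cong (Sum.map₂ (ς ⟨$⟩ʳ_)) (proj₂ c₂)))
                   (∈-map⁺ inj₂ (proj₂ (orderNew-ordered (proj₁ c₁) (proj₁ c₂))))

module CompetitionDigraph {k} (k≤3 : k ≤ 3) {D : Digraph (12 + k)} (acyclic : Acyclic D)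
                          (competes : IsCompetitionGraphOf (IcoPlus k) D) where

  old : Vertex → Fin (12 + k)
  old a = a ↑ˡ k

  IcoPlus⇒Ico : ∀ a b → IcoPlus k (old a) (old b) → Ico a b
  IcoPlus⇒Ico a b rewrite splitAt-↑ˡ 12 a k | splitAt-↑ˡ 12 b k = λ ab → ab

  Ico⇒IcoPlus : ∀ a b → Ico a b → IcoPlus k (old a) (old b)
  Ico⇒IcoPlus a b rewrite splitAt-↑ˡ 12 a k | splitAt-↑ˡ 12 b k = λ ab → ab

  new : Fin k → Fin 3
  new i = inject≤ i k≤3

  encode : Fin (12 + k) → Colour
  encode w = Sum.map₂ new (splitAt 12 w)

  encode-injective : ∀ {w w′} → encode w ≡ encode w′ → w ≡ w′
  encode-injective {w} {w′} same =
    trans (sym (join-splitAt 12 k w))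
          (trans (cong (join 12 k) (map₂-injective (splitAt 12 w) (splitAt 12 w′) same))
                 (join-splitAt 12 k w′))
    where
      map₂-injective : ∀ s s′ → Sum.map₂ new s ≡ Sum.map₂ new s′ → s ≡ s′
      map₂-injective (inj₁ a) (inj₁ .a) refl = refl
      map₂-injective (inj₂ i) (inj₂ j)  eq   = cong inj₂ (inject≤-injective k≤3 k≤3 i j (inj₂-injective eq))

  encode-old : ∀ a → encode (old a) ≡ inj₁ a
  encode-old a = cong (Sum.map₂ new) (splitAt-↑ˡ 12 a k)

  Eats : Vertex → Colour → Set
  Eats a c = ∃ λ w → encode w ≡ c × D (old a) w

  commonPrey : ∀ {a b} → Adjacent a b → ∃ λ w → D (old a) w × D (old b) w
  commonPrey {a} {b} e =
    proj₁ (competes (old a) (old b) distinct) (Ico⇒IcoPlus a b (Adjacent⇒Ico a b e))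
    where
      distinct : old a ≢ old b
      distinct same = adjacent-irreflexive a (subst (Adjacent a) (sym (↑ˡ-injective k a b same)) e)

  prey : Vertex → Vertex → Colour
  prey a b with adjacent? a b
  ... | yes e = encode (proj₁ (commonPrey e))
  ... | no  _ = inj₂ 0F

  prey-eaten : ∀ {a b} → Adjacent a b → Eats a (prey a b) × Eats b (prey a b)
  prey-eaten {a} {b} e with adjacent? a b
  ... | yes e′ = let w , aw , bw = commonPrey e′ in (w , refl , aw) , (w , refl , bw)
  ... | no  ¬e = ⊥-elim (¬e e)

  competition : ∀ {a b c} → Eats a c → Eats b c → Compatible a b
  competition {a} {b} (w , refl , aw) (w′ , same , bw′) with a ≟ b
  ... | yes a≡b = inj₁ a≡b
  ... | no  a≢b = inj₂ (Ico⇒Adjacent a b (IcoPlus⇒Ico a b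
        (proj₂ (competes (old a) (old b) (a≢b ∘ ↑ˡ-injective k a b))
               (w , aw , subst (D (old b)) (encode-injective same) bw′))))

  preyStructure : PreyStructure
  preyStructure = record
    { Eats = Eats ; prey = prey ; prey-eaten = prey-eaten ; competition = competition }

  -- A decidable subrelation of D on the old vertices, hence acyclic.
  Hunts : Vertex → Vertex → Set
  Hunts u v = ∃ λ b → Adjacent u b × prey u b ≡ inj₁ v

  hunts? : ∀ u v → Dec (Hunts u v)
  hunts? u v = any? λ b → adjacent? u b ×-dec prey u b ≟ᶜ inj₁ v

  Hunts⇒D : ∀ {u v} → Hunts u v → D (old u) (old v)
  Hunts⇒D {v = v} (b , e , hunted) =
    let w , encoded , uw = proj₁ (prey-eaten e)
    in subst (D _) (encode-injective (trans encoded (trans hunted (sym (encode-old v))))) uw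

  hunts-acyclic : Acyclic Hunts
  hunts-acyclic u cycle = acyclic (old u) (DPath-map old Hunts⇒D cycle)

  preysWithin : ∀ {olds u} → (∀ {v} → Hunts u v → v ∈ olds) →
                PreyStructure.PreysWithin preyStructure olds u
  preysWithin {u = u} exits {b} e with prey u b in hunted
  ... | inj₁ v = exits (b , e , hunted)
  ... | inj₂ _ = tt

  lastSink : (olds : List Vertex) → length olds ℕ.< 12 →
             ∃ λ u → u ∉ olds × PreyStructure.PreysWithin preyStructure olds u
  lastSink olds short =
    let u , u∉ , exits = ∃-sinkOutside {R = Hunts} hunts? hunts-acyclic olds short
    in u , u∉ , preysWithin exits

  impossible : ⊥
  impossible =
    let z , _  , atZ = lastSink []           z<s
        y , y∉ , atY = lastSink (z ∷ [])     (s<s z<s)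
        x , x∉ , atX = lastSink (y ∷ z ∷ []) (s<s (s<s z<s))
    in noThreeSinks preyStructure y∉ x∉ atZ atY atX

lemma3p1 : (k : ℕ) → IcoPlusIsCompetition k → 4 ≤ k
lemma3p1 k (D , acyclic , competes) with 4 ≤? k
... | yes 4≤k = 4≤k
... | no  4≰k = ⊥-elim (CompetitionDigraph.impossible (≤-pred (≰⇒> 4≰k)) acyclic competes)
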